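{- Let $D$ be an $\mathrm{STS}_2(v)$ on $V=\mathbb{F}_2^v$ which is invariant under $\langle A_{v,f}\rangle$, where $f\in\{0,\ldots,v-1\}$ with $v-f$ even. Let $F$ be the eigenspace of $A_{v,f}$ for the eigenvalue $1$ (of dimension $f$), and let $F_7$ be the set of blocks of $D$ that are fixed planes of type $7$. Then $F_7$ is an $\mathrm{STS}_2(f)$ on $F$, i.e. every $2$-dimensional subspace of $F$ is contained in exactly one element of $F_7$, and all elements of $F_7$ are contained in $F$.
   Context: An $\mathrm{STS}_2(v)$ on $V=\mathbb{F}_2^v$ is a set of $3$-dimensional subspaces (blocks) of $V$ such that every $2$-dimensional subspace of $V$ lies in exactly one block. $A_{v,f}$ is the block-diagonal matrix over $\mathbb{F}_2$ consisting of $\frac{v-f}{2}$ consecutive blocks $\begin{pmatrix}0&1\\1&1\end{pmatrix}$ followed by an $f\times f$ identity matrix, acting on subspaces via $\mathbf{x}\mapsto\mathbf{x}A_{v,f}$. A plane ($3$-subspace) fixed by this action is of type $7$ if all $7$ of its points ($1$-subspaces) are fixed. -}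

module Defs where

open import Data.Bool using (Bool; true; false; _xor_; _∧_; _∨_; not; if_then_else_)
open import Data.Nat using (ℕ; zero; suc; _+_; _*_; _∸_; _/_; _%_; _<ᵇ_; _≡ᵇ_)
open import Data.Fin using (Fin; toℕ)
open import Data.Vec using (Vec; []; _∷_; zipWith; replicate; tabulate)
open import Data.Product using (Σ; ∃; _×_; _,_)
open import Relation.Binary.PropositionalEquality using (_≡_)

-- Vectors of F_2^v (F_2 = Bool with xor as addition, ∧ as multiplication)
Vector : ℕ → Set
Vector v = Vec Bool v

zeroV : (v : ℕ) → Vector v
zeroV v = replicate v false

_⊕_ : {v : ℕ} → Vector v → Vector v → Vector v
_⊕_ = zipWith _xor_

_·_ : {v : ℕ} → Bool → Vector v → Vector v
true · x = x
false · x = zeroV _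

lincomb : {v k : ℕ} → Vec Bool k → Vec (Vector v) k → Vector v
lincomb {v} [] [] = zeroV v
lincomb (c ∷ cs) (b ∷ bs) = (c · b) ⊕ lincomb cs bs

-- v×v matrices over F_2, given as their list of rows
Matrix : ℕ → Set
Matrix v = Vec (Vector v) v

_*ᴹ_ : {v : ℕ} → Vector v → Matrix v → Vector v
x *ᴹ A = lincomb x A

-- A_{v,f}: (v-f)/2 diagonal blocks [[0,1],[1,1]] followed by the f×f identity.
A : (v f : ℕ) → Matrix v
A v f = tabulate λ i → tabulate λ j → entry (toℕ i) (toℕ j)
  where
  m2 : ℕ
  m2 = 2 * ((v ∸ f) / 2)
  entry : ℕ → ℕ → Bool
  entry i j =
    if (i <ᵇ m2) ∧ (j <ᵇ m2)
    then ((i / 2) ≡ᵇ (j / 2)) ∧ not ((i % 2 ≡ᵇ 0) ∧ (j % 2 ≡ᵇ 0))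
    else (not (i <ᵇ m2) ∧ not (j <ᵇ m2) ∧ (i ≡ᵇ j))

Subset : ℕ → Set
Subset v = Vector v → Bool

_∈ₛ_ : {v : ℕ} → Vector v → Subset v → Set
x ∈ₛ S = S x ≡ true

_⊆ₛ_ : {v : ℕ} → Subset v → Subset v → Set
S ⊆ₛ T = ∀ x → x ∈ₛ S → x ∈ₛ T

LinIndep : {v k : ℕ} → Vec (Vector v) k → Set
LinIndep {v} {k} b = ∀ (c : Vec Bool k) → lincomb c b ≡ zeroV v → c ≡ replicate k false

IsSubspaceOfDim : {v : ℕ} → ℕ → Subset v → Set
IsSubspaceOfDim {v} k S =
  Σ (Vec (Vector v) k) λ b →
    LinIndep b × (∀ x → (x ∈ₛ S → ∃ λ c → lincomb c b ≡ x) × ((∃ λ c → lincomb c b ≡ x) → x ∈ₛ S))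

IsSTS2 : (v b : ℕ) → (Fin b → Subset v) → Set
IsSTS2 v b D =
  (∀ i → IsSubspaceOfDim 3 (D i)) ×
  (∀ (L : Subset v) → IsSubspaceOfDim 2 L →
     Σ (Fin b) λ i → (L ⊆ₛ D i) × (∀ j → L ⊆ₛ D j → j ≡ i))

_≈ₛ_ : {v : ℕ} → Subset v → Subset v → Set
S ≈ₛ T = S ⊆ₛ T × T ⊆ₛ S

_∈Img_by_ : {v : ℕ} → Vector v → Subset v → Matrix v → Set
y ∈Img S by M = ∃ λ x → x ∈ₛ S × (x *ᴹ M ≡ y)

FixedBy : {v : ℕ} → Matrix v → Subset v → Set
FixedBy M S = ∀ y → (y ∈ₛ S → y ∈Img S by M) × (y ∈Img S by M → y ∈ₛ S)

InvariantUnder : {v b : ℕ} → Matrix v → (Fin b → Subset v) → Set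
InvariantUnder {v} {b} M D =
  (∀ i → Σ (Fin b) λ j → ∀ y → (y ∈Img D i by M → y ∈ₛ D j) × (y ∈ₛ D j → y ∈Img D i by M)) ×
  (∀ j → Σ (Fin b) λ i → ∀ y → (y ∈Img D i by M → y ∈ₛ D j) × (y ∈ₛ D j → y ∈Img D i by M))

-- a fixed plane of type 7: fixed as a subspace and all of its points (1-subspaces ⟨x⟩,
-- x ≠ 0) are fixed; over F_2, ⟨x⟩ is fixed iff x M = x
FixedType7 : {v : ℕ} → Matrix v → Subset v → Set
FixedType7 M S = FixedBy M S × (∀ x → x ∈ₛ S → x *ᴹ M ≡ x)

InEig1 : {v : ℕ} → Matrix v → Vector v → Set
InEig1 M x = x *ᴹ M ≡ x

-- Let L be a line (2-subspace) of fixed points. The block through L is unique, and its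
-- image under A is again a block through L, so that block is a fixed plane. A maps each
-- coordinate pair (a, b) to (b, a + b) and fixes the remaining coordinates, so A³ = 1.
-- On the fixed plane A fixes the line L pointwise; over F₂ such a map is unipotent, so
-- its order divides both 2 and 3, and it is the identity: every point of the block is
-- fixed. The second claim is part of the definition of type 7.

module Submission where

open import Defs
open import Algebra using (CommutativeRing)
open import Data.Bool using (Bool; true; false; _xor_; _∧_; not; if_then_else_)
open import Data.Bool.Properties
  using (_≟_; xor-assoc; xor-same; xor-identityˡ; xor-identityʳ; xor-∧-commutativeRing; ∧-zeroʳ; ∧-identityʳ)
open import Data.Fin using (Fin; zero; suc; toℕ)
open import Data.Nat using (ℕ; zero; suc; _+_; _*_; _∸_; _/_; _%_; _<ᵇ_; _≡ᵇ_; _≤_; _<_; z≤n; s≤s)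
open import Data.Nat.Divisibility using (_∣_)
open import Data.Nat.DivMod using (m/n≡1+[m∸n]/n; m/n*n≤m)
open import Data.Nat.Properties using (*-comm; ≤-trans; m∸n≤m)
open import Data.Product using (Σ; ∃; _×_; _,_; proj₁; proj₂)
open import Data.Vec using (Vec; []; _∷_; replicate; map; tabulate; lookup)
open import Data.Vec.Properties
  using (≡-dec; zipWith-assoc; zipWith-identityˡ; zipWith-identityʳ; lookup-zipWith; lookup-replicate;
         lookup∘tabulate; tabulate∘lookup; tabulate-cong; map-∘; map-cong; lookup-map)
open import Function using (_∘_)
open import Relation.Binary.PropositionalEquality
  using (_≡_; refl; sym; trans; cong; cong₂; subst; module ≡-Reasoning)
open import Relation.Nullary.Decidable using (Dec; map′; _×-dec_; _→-dec_; toWitness)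
open import Relation.Unary using (Decidable)

open import Algebra.Properties.CommutativeSemigroup
  (CommutativeRing.+-commutativeSemigroup xor-∧-commutativeRing) using (interchange)

⊕-assoc : ∀ {n} (x y z : Vector n) → (x ⊕ y) ⊕ z ≡ x ⊕ (y ⊕ z)
⊕-assoc = zipWith-assoc xor-assoc

⊕-identityˡ : ∀ {n} (x : Vector n) → zeroV n ⊕ x ≡ x
⊕-identityˡ = zipWith-identityˡ xor-identityˡ

⊕-identityʳ : ∀ {n} (x : Vector n) → x ⊕ zeroV n ≡ x
⊕-identityʳ = zipWith-identityʳ xor-identityʳ

⊕-self : ∀ {n} (x : Vector n) → x ⊕ x ≡ zeroV n
⊕-self []      = refl
⊕-self (a ∷ x) = cong₂ _∷_ (xor-same a) (⊕-self x)

⊕-interchange : ∀ {n} (w x y z : Vector n) → (w ⊕ x) ⊕ (y ⊕ z) ≡ (w ⊕ y) ⊕ (x ⊕ z)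
⊕-interchange []       []       []       []       = refl
⊕-interchange (a ∷ w) (b ∷ x) (c ∷ y) (d ∷ z) = cong₂ _∷_ (interchange a b c d) (⊕-interchange w x y z)

⊕≡zero⇒≡ : ∀ {n} (x y : Vector n) → x ⊕ y ≡ zeroV n → x ≡ y
⊕≡zero⇒≡ {n} x y x⊕y≡0 = begin
  x                ≡⟨ sym (⊕-identityʳ x) ⟩
  x ⊕ zeroV n      ≡⟨ cong (x ⊕_) (sym (⊕-self y)) ⟩
  x ⊕ (y ⊕ y)      ≡⟨ sym (⊕-assoc x y y) ⟩
  (x ⊕ y) ⊕ y      ≡⟨ cong (_⊕ y) x⊕y≡0 ⟩
  zeroV n ⊕ y      ≡⟨ ⊕-identityˡ y ⟩
  y                ∎
  where open ≡-Reasoning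

·-distrib-xor : ∀ {n} a b (x : Vector n) → (a xor b) · x ≡ (a · x) ⊕ (b · x)
·-distrib-xor true  true  x = sym (⊕-self x)
·-distrib-xor true  false x = sym (⊕-identityʳ x)
·-distrib-xor false b     x = sym (⊕-identityˡ (b · x))

lincomb-zero : ∀ {v k} (bs : Vec (Vector v) k) → lincomb (zeroV k) bs ≡ zeroV v
lincomb-zero []       = refl
lincomb-zero (b ∷ bs) = trans (⊕-identityˡ _) (lincomb-zero bs)

lincomb-distrib-⊕ : ∀ {v k} (c d : Vector k) (bs : Vec (Vector v) k) →
  lincomb (c ⊕ d) bs ≡ lincomb c bs ⊕ lincomb d bs
lincomb-distrib-⊕ {v} [] [] [] = sym (⊕-self (zeroV v))
lincomb-distrib-⊕ (a ∷ c) (b ∷ d) (x ∷ bs) =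
  trans (cong₂ _⊕_ (·-distrib-xor a b x) (lincomb-distrib-⊕ c d bs))
        (⊕-interchange (a · x) (b · x) _ _)

lincomb-· : ∀ {v k} a (c : Vector k) (bs : Vec (Vector v) k) → lincomb (a · c) bs ≡ a · lincomb c bs
lincomb-· true  c bs = refl
lincomb-· false c bs = lincomb-zero bs

lincomb-assoc : ∀ {v k m} (c : Vector m) (Cs : Vec (Vector k) m) (bs : Vec (Vector v) k) →
  lincomb c (map (λ t → lincomb t bs) Cs) ≡ lincomb (lincomb c Cs) bs
lincomb-assoc []      []       bs = sym (lincomb-zero bs)
lincomb-assoc (a ∷ c) (t ∷ Cs) bs =
  trans (cong₂ _⊕_ (sym (lincomb-· a t bs)) (lincomb-assoc c Cs bs))
        (sym (lincomb-distrib-⊕ (a · t) (lincomb c Cs) bs))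

lincomb-injective : ∀ {v k} {bs : Vec (Vector v) k} → LinIndep bs →
  ∀ c d → lincomb c bs ≡ lincomb d bs → c ≡ d
lincomb-injective {bs = bs} indep c d eq = ⊕≡zero⇒≡ c d (indep (c ⊕ d) (begin
  lincomb (c ⊕ d) bs            ≡⟨ lincomb-distrib-⊕ c d bs ⟩
  lincomb c bs ⊕ lincomb d bs   ≡⟨ cong (_⊕ lincomb d bs) eq ⟩
  lincomb d bs ⊕ lincomb d bs   ≡⟨ ⊕-self _ ⟩
  zeroV _                       ∎))
  where open ≡-Reasoning

identity : ∀ k → Vec (Vector k) k
identity zero    = []
identity (suc k) = (true ∷ zeroV k) ∷ map (false ∷_) (identity k)

lincomb-identity : ∀ {v k} (bs : Vec (Vector v) k) → map (λ e → lincomb e bs) (identity k) ≡ bs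
lincomb-identity []       = refl
lincomb-identity {k = suc k} (b ∷ bs) = cong₂ _∷_
  (trans (cong (b ⊕_) (lincomb-zero bs)) (⊕-identityʳ b))
  (begin
    map (λ e → lincomb e (b ∷ bs)) (map (false ∷_) (identity k)) ≡⟨ map-∘ _ _ (identity k) ⟨
    map (λ e → zeroV _ ⊕ lincomb e bs) (identity k)              ≡⟨ map-cong (λ e → ⊕-identityˡ (lincomb e bs)) (identity k) ⟩
    map (λ e → lincomb e bs) (identity k)                         ≡⟨ lincomb-identity bs ⟩
    bs                                                             ∎)
  where open ≡-Reasoning

vec-ext : ∀ {n} {x y : Vector n} → (∀ j → lookup x j ≡ lookup y j) → x ≡ y
vec-ext {x = x} {y} eq = trans (sym (tabulate∘lookup x)) (trans (tabulate-cong eq) (tabulate∘lookup y))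

xorSum : ∀ {n} → Vector n → (ℕ → Bool) → Bool
xorSum []       g = false
xorSum (c ∷ cs) g = (c ∧ g 0) xor xorSum cs (g ∘ suc)

xorSum-cong : ∀ {n} (x : Vector n) {g h : ℕ → Bool} → (∀ i → g i ≡ h i) → xorSum x g ≡ xorSum x h
xorSum-cong []       g≗h = refl
xorSum-cong (c ∷ cs) g≗h = cong₂ (λ a s → (c ∧ a) xor s) (g≗h 0) (xorSum-cong cs (g≗h ∘ suc))

xorSum-false : ∀ {n} (x : Vector n) → xorSum x (λ _ → false) ≡ false
xorSum-false []       = refl
xorSum-false (c ∷ cs) rewrite ∧-zeroʳ c = xorSum-false cs

xorSum-select : ∀ {n} (x : Vector n) (j : Fin n) → xorSum x (λ i → i ≡ᵇ toℕ j) ≡ lookup x j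
xorSum-select (c ∷ cs) zero    rewrite xorSum-false cs | ∧-identityʳ c = xor-identityʳ c
xorSum-select (c ∷ cs) (suc j) rewrite ∧-zeroʳ c = xorSum-select cs j

lookup-· : ∀ {n} a (x : Vector n) j → lookup (a · x) j ≡ a ∧ lookup x j
lookup-· true  x j = refl
lookup-· false x j = lookup-replicate j false

lookup-lincomb-tabulate : ∀ {k n} (x : Vector k) (g : ℕ → ℕ → Bool) (j : Fin n) →
  lookup (lincomb x (tabulate λ i → tabulate λ j → g (toℕ i) (toℕ j))) j ≡ xorSum x (λ i → g i (toℕ j))
lookup-lincomb-tabulate []      g j = lookup-replicate j false
lookup-lincomb-tabulate {n = n} (a ∷ x) g j = begin
  lookup ((a · row₀) ⊕ rest) j          ≡⟨ lookup-zipWith _xor_ j (a · row₀) rest ⟩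
  lookup (a · row₀) j xor lookup rest j ≡⟨ cong₂ _xor_ (lookup-· a row₀ j) (lookup-lincomb-tabulate x (g ∘ suc) j) ⟩
  (a ∧ lookup row₀ j) xor restSum       ≡⟨ cong (λ e → (a ∧ e) xor restSum) (lookup∘tabulate _ j) ⟩
  (a ∧ g 0 (toℕ j)) xor restSum         ∎
  where
  open ≡-Reasoning
  row₀ rest : Vector n
  row₀ = tabulate λ j → g 0 (toℕ j)
  rest = lincomb x (tabulate λ i → tabulate λ j → g (suc (toℕ i)) (toℕ j))
  restSum : Bool
  restSum = xorSum x (λ i → g (suc i) (toℕ j))

-- A v f is definitionally  tabulate λ i → tabulate λ j → entryA (2 * ((v ∸ f) / 2)) (toℕ i) (toℕ j).
entryA : ℕ → ℕ → ℕ → Bool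
entryA m i j =
  if (i <ᵇ m) ∧ (j <ᵇ m)
  then ((i / 2) ≡ᵇ (j / 2)) ∧ not ((i % 2 ≡ᵇ 0) ∧ (j % 2 ≡ᵇ 0))
  else (not (i <ᵇ m) ∧ not (j <ᵇ m) ∧ (i ≡ᵇ j))

[2+i]/2≡1+i/2 : ∀ i → (2 + i) / 2 ≡ suc (i / 2)
[2+i]/2≡1+i/2 i = m/n≡1+[m∸n]/n {2 + i} {2} (s≤s (s≤s z≤n))

entryA-shift : ∀ m i j → entryA (2 + m) (2 + i) (2 + j) ≡ entryA m i j
entryA-shift m i j rewrite [2+i]/2≡1+i/2 i | [2+i]/2≡1+i/2 j = refl

entryA-below-block : ∀ m i → entryA (2 + m) (2 + i) 0 ≡ false × entryA (2 + m) (2 + i) 1 ≡ false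
entryA-below-block m i rewrite [2+i]/2≡1+i/2 i with i <ᵇ m
... | true  = refl , refl
... | false = refl , refl

entryA-right-of-block : ∀ m j → entryA (2 + m) 0 (2 + j) ≡ false × entryA (2 + m) 1 (2 + j) ≡ false
entryA-right-of-block m j rewrite [2+i]/2≡1+i/2 j with j <ᵇ m
... | true  = refl , refl
... | false = refl , refl

rotatePairs : ∀ {n} → ℕ → Vector n → Vector n
rotatePairs zero    x                = x
rotatePairs (suc k) []               = []
rotatePairs (suc k) (a ∷ [])         = a ∷ []
rotatePairs (suc k) (a ∷ b ∷ x)      = b ∷ (a xor b) ∷ rotatePairs k x

rotatePairs-cube : ∀ {n} k (x : Vector n) → rotatePairs k (rotatePairs k (rotatePairs k x)) ≡ x
rotatePairs-cube zero    x           = refl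
rotatePairs-cube (suc k) []          = refl
rotatePairs-cube (suc k) (a ∷ [])    = refl
rotatePairs-cube (suc k) (a ∷ b ∷ x) rewrite rotatePairs-cube k x with a | b
... | true  | true  = refl
... | true  | false = refl
... | false | true  = refl
... | false | false = refl

-- Stated with k * 2 rather than 2 * k because suc k * 2 reduces to suc (suc (k * 2)).
xorSum-entryA : ∀ k {n} (x : Vector n) (j : Fin n) → k * 2 ≤ n →
  xorSum x (λ i → entryA (k * 2) i (toℕ j)) ≡ lookup (rotatePairs k x) j
xorSum-entryA zero    x           j                   _ = xorSum-select x j
xorSum-entryA (suc k) (a ∷ [])    zero                (s≤s ())
xorSum-entryA (suc k) (a ∷ b ∷ x) zero                _
  rewrite xorSum-cong x (λ i → proj₁ (entryA-below-block (k * 2) i)) | xorSum-false x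
        | ∧-zeroʳ a | ∧-identityʳ b = xor-identityʳ b
xorSum-entryA (suc k) (a ∷ b ∷ x) (suc zero)          _
  rewrite xorSum-cong x (λ i → proj₂ (entryA-below-block (k * 2) i)) | xorSum-false x
        | ∧-identityʳ a | ∧-identityʳ b | xor-identityʳ b = refl
xorSum-entryA (suc k) (a ∷ b ∷ x) (suc (suc j)) (s≤s (s≤s 2k≤n))
  rewrite proj₁ (entryA-right-of-block (k * 2) (toℕ j)) | proj₂ (entryA-right-of-block (k * 2) (toℕ j))
        | ∧-zeroʳ a | ∧-zeroʳ b | xorSum-cong x (λ i → entryA-shift (k * 2) i (toℕ j)) =
  xorSum-entryA k x j 2k≤n

*ᴹ-A≡rotatePairs : ∀ v f (x : Vector v) → x *ᴹ A v f ≡ rotatePairs ((v ∸ f) / 2) x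
*ᴹ-A≡rotatePairs v f x = vec-ext λ j → begin
  lookup (x *ᴹ A v f) j                          ≡⟨ lookup-lincomb-tabulate x (entryA (2 * K)) j ⟩
  xorSum x (λ i → entryA (2 * K) i (toℕ j))      ≡⟨ cong (λ m → xorSum x (λ i → entryA m i (toℕ j))) (*-comm 2 K) ⟩
  xorSum x (λ i → entryA (K * 2) i (toℕ j))      ≡⟨ xorSum-entryA K x j (≤-trans (m/n*n≤m (v ∸ f) 2) (m∸n≤m v f)) ⟩
  lookup (rotatePairs K x) j                     ∎
  where
  open ≡-Reasoning
  K : ℕ
  K = (v ∸ f) / 2

A-cube : ∀ v f (x : Vector v) → ((x *ᴹ A v f) *ᴹ A v f) *ᴹ A v f ≡ x
A-cube v f x = begin
  ((x *ᴹ A v f) *ᴹ A v f) *ᴹ A v f                     ≡⟨ cong (λ y → (y *ᴹ A v f) *ᴹ A v f) (*ᴹ-A≡rotatePairs v f x) ⟩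
  (rotatePairs K x *ᴹ A v f) *ᴹ A v f                  ≡⟨ cong (_*ᴹ A v f) (*ᴹ-A≡rotatePairs v f (rotatePairs K x)) ⟩
  rotatePairs K (rotatePairs K x) *ᴹ A v f             ≡⟨ *ᴹ-A≡rotatePairs v f (rotatePairs K (rotatePairs K x)) ⟩
  rotatePairs K (rotatePairs K (rotatePairs K x))      ≡⟨ rotatePairs-cube K x ⟩
  x                                                    ∎
  where
  open ≡-Reasoning
  K : ℕ
  K = (v ∸ f) / 2

Searchable : Set → Set₁
Searchable A = ∀ {P : A → Set} → Decidable P → Dec (∀ x → P x)

searchable-Bool : Searchable Bool
searchable-Bool P? = map′ (λ (Pf , Pt) → λ { false → Pf ; true → Pt }) (λ ∀P → ∀P false , ∀P true)
  (P? false ×-dec P? true)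

searchable-Vec : ∀ {A} n → Searchable A → Searchable (Vec A n)
searchable-Vec zero    _   P? = map′ (λ P[] → λ { [] → P[] }) (λ ∀P → ∀P []) (P? [])
searchable-Vec (suc n) ∀A? P? = map′ (λ ∀P → λ { (x ∷ xs) → ∀P x xs }) (λ ∀P x xs → ∀P (x ∷ xs))
  (∀A? λ x → searchable-Vec n ∀A? λ xs → P? (x ∷ xs))

∀F₂? : ∀ n → Searchable (Vector n)
∀F₂? n = searchable-Vec n searchable-Bool

infix 4 _≟ᵥ_
_≟ᵥ_ : ∀ {n} (x y : Vector n) → Dec (x ≡ y)
_≟ᵥ_ = ≡-dec _≟_

-- T fixes the line ⟨p, q⟩ pointwise and, over F₂, acts trivially on the 1-dimensional
-- quotient, so T = 1 + N with N² = 0 and T³ = 1 + N; hence T³ = 1 forces N = 0.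
order-3-fixing-line⇒identity : ∀ (T : Matrix 3) (p q : Vector 3) →
  p *ᴹ T ≡ p → q *ᴹ T ≡ q → LinIndep (p ∷ q ∷ []) → (∀ c → ((c *ᴹ T) *ᴹ T) *ᴹ T ≡ c) →
  ∀ c → c *ᴹ T ≡ c
order-3-fixing-line⇒identity = toWitness {a? = searchable-Vec 3 (∀F₂? 3) λ T → ∀F₂? 3 λ p → ∀F₂? 3 λ q →
  (p *ᴹ T ≟ᵥ p) →-dec (q *ᴹ T ≟ᵥ q) →-dec
  ∀F₂? 2 (λ c → (lincomb c (p ∷ q ∷ []) ≟ᵥ zeroV 3) →-dec (c ≟ᵥ replicate 2 false)) →-dec
  ∀F₂? 3 (λ c → ((c *ᴹ T) *ᴹ T) *ᴹ T ≟ᵥ c) →-dec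
  ∀F₂? 3 (λ c → c *ᴹ T ≟ᵥ c)} _

IsBasisOf : ∀ {v k} → Vec (Vector v) k → Subset v → Set
IsBasisOf bs S = LinIndep bs × (∀ x → (x ∈ₛ S → ∃ λ c → lincomb c bs ≡ x) × ((∃ λ c → lincomb c bs ≡ x) → x ∈ₛ S))

module _ {v k} {bs : Vec (Vector v) k} {S : Subset v} (basis : IsBasisOf bs S) where

  coordinates : ∀ {x} → x ∈ₛ S → ∃ λ c → lincomb c bs ≡ x
  coordinates {x} x∈S = proj₁ (proj₂ basis x) x∈S

  span⊆ : ∀ c → lincomb c bs ∈ₛ S
  span⊆ c = proj₂ (proj₂ basis _) (c , refl)

  basis⊆ : ∀ i → lookup bs i ∈ₛ S
  basis⊆ i = subst (_∈ₛ S) eq (span⊆ (lookup (identity k) i))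
    where
    eq : lincomb (lookup (identity k) i) bs ≡ lookup bs i
    eq = trans (sym (lookup-map i (λ e → lincomb e bs) (identity k))) (cong (λ B → lookup B i) (lincomb-identity bs))

  restriction-matrix : (M : Matrix v) → (∀ x → x ∈ₛ S → (x *ᴹ M) ∈ₛ S) →
    Σ (Matrix k) λ T → ∀ c → lincomb c bs *ᴹ M ≡ lincomb (c *ᴹ T) bs
  restriction-matrix M closed = T , λ c → begin
    lincomb (lincomb c bs) M                                 ≡⟨ lincomb-assoc c bs M ⟨
    lincomb c (map (_*ᴹ M) bs)                               ≡⟨ cong (lincomb c ∘ map (_*ᴹ M)) (lincomb-identity bs) ⟨
    lincomb c (map (_*ᴹ M) (map (λ e → lincomb e bs) I))     ≡⟨ cong (lincomb c) (map-∘ _ _ I) ⟨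
    lincomb c (map (λ e → lincomb e bs *ᴹ M) I)              ≡⟨ cong (lincomb c) (map-cong (λ e → sym (proj₂ (image e))) I) ⟩
    lincomb c (map (λ e → lincomb (proj₁ (image e)) bs) I)   ≡⟨ cong (lincomb c) (map-∘ _ _ I) ⟩
    lincomb c (map (λ t → lincomb t bs) T)                   ≡⟨ lincomb-assoc c T bs ⟩
    lincomb (c *ᴹ T) bs                                      ∎
    where
    open ≡-Reasoning
    I : Vec (Vector k) k
    I = identity k
    image : ∀ e → ∃ λ t → lincomb t bs ≡ lincomb e bs *ᴹ M
    image e = coordinates (closed _ (span⊆ e))
    T : Matrix k
    T = map (λ e → proj₁ (image e)) I

LinIndep-coordinates : ∀ {v k m} (bs : Vec (Vector v) k) (Cs : Vec (Vector k) m) →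
  LinIndep (map (λ t → lincomb t bs) Cs) → LinIndep Cs
LinIndep-coordinates bs Cs indep c c·Cs≡0 =
  indep c (trans (lincomb-assoc c Cs bs) (trans (cong (λ t → lincomb t bs) c·Cs≡0) (lincomb-zero bs)))

module _ {v k} {bs : Vec (Vector v) k} (indep : LinIndep bs) {M : Matrix v} {T : Matrix k}
         (rep : ∀ c → lincomb c bs *ᴹ M ≡ lincomb (c *ᴹ T) bs) where

  fixed⇒coordinates-fixed : ∀ c → lincomb c bs *ᴹ M ≡ lincomb c bs → c *ᴹ T ≡ c
  fixed⇒coordinates-fixed c fixed = lincomb-injective indep _ _ (trans (sym (rep c)) fixed)

  cube-id⇒coordinates-cube-id : (∀ x → ((x *ᴹ M) *ᴹ M) *ᴹ M ≡ x) → ∀ c → ((c *ᴹ T) *ᴹ T) *ᴹ T ≡ c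
  cube-id⇒coordinates-cube-id cube c = lincomb-injective indep _ _ (begin
    lincomb (((c *ᴹ T) *ᴹ T) *ᴹ T) bs   ≡⟨ rep ((c *ᴹ T) *ᴹ T) ⟨
    lincomb ((c *ᴹ T) *ᴹ T) bs *ᴹ M     ≡⟨ cong (_*ᴹ M) (rep (c *ᴹ T)) ⟨
    (lincomb (c *ᴹ T) bs *ᴹ M) *ᴹ M     ≡⟨ cong (λ y → (y *ᴹ M) *ᴹ M) (rep c) ⟨
    ((lincomb c bs *ᴹ M) *ᴹ M) *ᴹ M     ≡⟨ cube _ ⟩
    lincomb c bs                        ∎)
    where open ≡-Reasoning

order-3-fixing-line⇒fixes-plane : ∀ {v} (M : Matrix v) → (∀ x → ((x *ᴹ M) *ᴹ M) *ᴹ M ≡ x) →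
  {P L : Subset v} → IsSubspaceOfDim 3 P → (∀ x → x ∈ₛ P → (x *ᴹ M) ∈ₛ P) →
  IsSubspaceOfDim 2 L → L ⊆ₛ P → (∀ x → x ∈ₛ L → x *ᴹ M ≡ x) →
  ∀ x → x ∈ₛ P → x *ᴹ M ≡ x
order-3-fixing-line⇒fixes-plane M cube (bs , P-basis) closed (l₁ ∷ l₂ ∷ [] , L-basis) L⊆P L-fixed x x∈P =
  begin
    x *ᴹ M              ≡⟨ cong (_*ᴹ M) x-coords ⟨
    lincomb c bs *ᴹ M   ≡⟨ rep c ⟩
    lincomb (c *ᴹ T) bs ≡⟨ cong (λ t → lincomb t bs) (T-identity c) ⟩
    lincomb c bs        ≡⟨ x-coords ⟩
    x                   ∎
  where
  open ≡-Reasoning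
  T : Matrix 3
  T = proj₁ (restriction-matrix P-basis M closed)
  rep : ∀ c → lincomb c bs *ᴹ M ≡ lincomb (c *ᴹ T) bs
  rep = proj₂ (restriction-matrix P-basis M closed)
  c : Vector 3
  c = proj₁ (coordinates P-basis x∈P)
  x-coords : lincomb c bs ≡ x
  x-coords = proj₂ (coordinates P-basis x∈P)
  l-coords : ∀ i → ∃ λ t → lincomb t bs ≡ lookup (l₁ ∷ l₂ ∷ []) i
  l-coords i = coordinates P-basis (L⊆P _ (basis⊆ L-basis i))
  l-coords-fixed : ∀ i → proj₁ (l-coords i) *ᴹ T ≡ proj₁ (l-coords i)
  l-coords-fixed i = fixed⇒coordinates-fixed (proj₁ P-basis) rep _
    (trans (cong (_*ᴹ M) (proj₂ (l-coords i))) (trans (L-fixed _ (basis⊆ L-basis i)) (sym (proj₂ (l-coords i)))))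
  p q : Vector 3
  p = proj₁ (l-coords zero)
  q = proj₁ (l-coords (suc zero))
  pq-indep : LinIndep (p ∷ q ∷ [])
  pq-indep = LinIndep-coordinates bs (p ∷ q ∷ [])
    (subst LinIndep (cong₂ _∷_ (sym (proj₂ (l-coords zero))) (cong₂ _∷_ (sym (proj₂ (l-coords (suc zero)))) refl))
           (proj₁ L-basis))
  T-identity : ∀ c → c *ᴹ T ≡ c
  T-identity = order-3-fixing-line⇒identity T p q (l-coords-fixed zero) (l-coords-fixed (suc zero)) pq-indep
    (cube-id⇒coordinates-cube-id (proj₁ P-basis) rep cube)

block-through-fixed-line-is-fixed : ∀ {v b} (M : Matrix v) (D : Fin b → Subset v) {L : Subset v} {i j : Fin b} →
  (∀ j → L ⊆ₛ D j → j ≡ i) →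
  (∀ y → (y ∈Img D i by M → y ∈ₛ D j) × (y ∈ₛ D j → y ∈Img D i by M)) →
  L ⊆ₛ D i → (∀ x → x ∈ₛ L → x *ᴹ M ≡ x) → FixedBy M (D i)
block-through-fixed-line-is-fixed M D unique image L⊆Di L-fixed
  with unique _ (λ y y∈L → proj₁ (image y) (y , L⊆Di y y∈L , L-fixed y y∈L))
... | refl = λ y → proj₂ (image y) , proj₁ (image y)

lemma5 : (v f b : ℕ) → f < v → 2 ∣ (v ∸ f) →
    (D : Fin b → Subset v) → IsSTS2 v b D → InvariantUnder (A v f) D →
    ((L : Subset v) → IsSubspaceOfDim 2 L → (∀ x → x ∈ₛ L → InEig1 (A v f) x) →
    Σ (Fin b) λ i → (FixedType7 (A v f) (D i) × L ⊆ₛ D i) ×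
    (∀ j → FixedType7 (A v f) (D j) × L ⊆ₛ D j → j ≡ i)) ×
    (∀ i → FixedType7 (A v f) (D i) → ∀ x → x ∈ₛ D i → InEig1 (A v f) x)
lemma5 v f b _ _ D (planes , unique-block) (image-block , _) =
  block-through-fixed-line , λ _ (_ , points-fixed) → points-fixed
  where
  block-through-fixed-line : (L : Subset v) → IsSubspaceOfDim 2 L → (∀ x → x ∈ₛ L → InEig1 (A v f) x) →
    Σ (Fin b) λ i → (FixedType7 (A v f) (D i) × L ⊆ₛ D i) × (∀ j → FixedType7 (A v f) (D j) × L ⊆ₛ D j → j ≡ i)
  block-through-fixed-line L L-dim L-fixed with unique-block L L-dim
  ... | i , L⊆Di , unique = i , ((Di-fixed , Di-points-fixed) , L⊆Di) , λ j (_ , L⊆Dj) → unique j L⊆Dj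
    where
    Di-fixed : FixedBy (A v f) (D i)
    Di-fixed = block-through-fixed-line-is-fixed (A v f) D unique (proj₂ (image-block i)) L⊆Di L-fixed
    Di-points-fixed : ∀ x → x ∈ₛ D i → InEig1 (A v f) x
    Di-points-fixed = order-3-fixing-line⇒fixes-plane (A v f) (A-cube v f) (planes i)
      (λ x x∈Di → proj₂ (Di-fixed _) (x , x∈Di , refl)) L-dim L⊆Di L-fixed
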